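{- Let $n\ge1$ and let $\lambda=(\lambda_1,\dots,\lambda_n)$ be a partition with at most $n$ nonzero parts, padded with zeros to length $n$. Let $\boldsymbol\beta=(\beta_1,\dots,\beta_{n-1})$ be parameters. Then, as rational functions of $q$, $$G_\lambda(1,q,q^2,\dots,q^{n-1}\mid\boldsymbol\beta)=\sum_{k_1=0}^{0}\sum_{k_2=0}^{1}\cdots\sum_{k_n=0}^{n-1} e^{(0)}_{k_1}e^{(1)}_{k_2}\cdots e^{(n-1)}_{k_n}\prod_{1\le i<j\le n}\frac{q^{\lambda_j+n-j+k_j}-q^{\lambda_i+n-i+k_i}}{q^{n-j}-q^{n-i}},$$ where $e^{(j-1)}_{k}=e_k(\beta_1,\dots,\beta_{j-1})$ is the $k$-th elementary symmetric polynomial in $\beta_1,\dots,\beta_{j-1}$ (with $e^{(j-1)}_0=1$). In particular, for the ordinary Grothendieck polynomial with a single parameter $\beta$, $$G_\lambda(1,q,\dots,q^{n-1}\mid\beta)=\sum_{k_1=0}^{0}\sum_{k_2=0}^{1}\cdots\sum_{k_n=0}^{n-1}\binom{0}{k_1}\binom{1}{k_2}\cdots\binom{n-1}{k_n}\beta^{k_1+\cdots+k_n}\prod_{1\le i<j\le n}\frac{q^{\lambda_j+n-j+k_j}-q^{\lambda_i+n-i+k_i}}{q^{n-j}-q^{n-i}}.$$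
   Context: The refined Grothendieck polynomial is defined by the bi-alternant $$G_\lambda(x_1,\dots,x_n\mid\boldsymbol\beta)=\frac{\det\Big(x_i^{\lambda_j+n-j}\prod_{m=1}^{j-1}(1+\beta_m x_i)\Big)_{1\le i,j\le n}}{\prod_{1\le i<j\le n}(x_i-x_j)}.$$ The (stable) Grothendieck polynomial $G_\lambda(x_1,\dots,x_n\mid\beta)$ is $\sum_{T}\beta^{|T|-|\lambda|}x^{\omega(T)}$, summed over set-valued tableaux $T$ of shape $\lambda$ with entries in $[n]$ (each box $(i,j)$ gets a non-empty $T_{i,j}\subseteq[n]$ with $\max T_{i,j}\le\min T_{i,j+1}$, $\max T_{i,j}<\min T_{i+1,j}$), where $|T|$ is the total number of entries, $|\lambda|$ the number of boxes, and $x^{\omega(T)}=\prod_m x_m^{\#\{\text{boxes containing } m\}}$; it is known to equal the refined polynomial with $\beta_1=\cdots=\beta_{n-1}=\beta$, i.e. $\det\big(x_i^{\lambda_j+n-j}(1+\beta x_i)^{j-1}\big)/\prod_{i<j}(x_i-x_j)$. -}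

module Defs where

open import Algebra.Bundles using (CommutativeRing)
open import Data.Nat as ℕ using (ℕ; zero; suc; _∸_; _≤_)
open import Data.Fin using (Fin; zero; suc; toℕ; punchIn; _<?_)
open import Data.Vec using (Vec; toList)
open import Data.List using (List; []; _∷_; take)
open import Data.Bool using (if_then_else_)
open import Relation.Nullary.Decidable using (⌊_⌋)
import Data.Vec.Functional as VF

IsPartition : (n : ℕ) → (Fin n → ℕ) → Set
IsPartition n lam = ∀ (i j : Fin n) → toℕ i ≤ toℕ j → lam j ≤ lam i

sumℕ : (n : ℕ) → (Fin n → ℕ) → ℕ
sumℕ zero f = 0
sumℕ (suc n) f = f zero ℕ.+ sumℕ n (λ i → f (suc i))

prodℕ : (n : ℕ) → (Fin n → ℕ) → ℕ
prodℕ zero f = 1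
prodℕ (suc n) f = f zero ℕ.* prodℕ n (λ i → f (suc i))

module WithRing {c ℓ} (R : CommutativeRing c ℓ) where
  open CommutativeRing R hiding (zero)

  pow : Carrier → ℕ → Carrier
  pow x zero = 1#
  pow x (suc k) = x * pow x k

  fromℕ : ℕ → Carrier
  fromℕ zero = 0#
  fromℕ (suc k) = 1# + fromℕ k

  sumTo : ℕ → (ℕ → Carrier) → Carrier
  sumTo zero g = g 0
  sumTo (suc N) g = sumTo N g + g (suc N)

  sumFin : (n : ℕ) → (Fin n → Carrier) → Carrier
  sumFin zero f = 0#
  sumFin (suc n) f = f zero + sumFin n (λ i → f (suc i))

  prodFin : (n : ℕ) → (Fin n → Carrier) → Carrier
  prodFin zero f = 1#
  prodFin (suc n) f = f zero * prodFin n (λ i → f (suc i))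

  prodList : List Carrier → Carrier
  prodList [] = 1#
  prodList (x ∷ xs) = x * prodList xs

  prodPairs : (n : ℕ) → (Fin n → Fin n → Carrier) → Carrier
  prodPairs n f = prodFin n (λ i → prodFin n (λ j → if ⌊ i <? j ⌋ then f i j else 1#))

  altSign : ℕ → Carrier
  altSign zero = 1#
  altSign (suc k) = - altSign k

  det : (n : ℕ) → (Fin n → Fin n → Carrier) → Carrier
  det zero M = 1#
  det (suc n) M =
    sumFin (suc n) (λ j → altSign (toℕ j) * (M zero j * det n (λ r s → M (suc r) (punchIn j s))))

  esym : ℕ → List Carrier → Carrier
  esym zero bs = 1#
  esym (suc k) [] = 0#
  esym (suc k) (b ∷ bs) = esym (suc k) bs + b * esym k bs

  sumBounded : (n : ℕ) → (Fin n → ℕ) → ((Fin n → ℕ) → Carrier) → Carrier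
  sumBounded zero bound F = F (λ ())
  sumBounded (suc n) bound F =
    sumTo (bound zero) (λ t → sumBounded n (λ i → bound (suc i)) (λ k → F (t VF.∷ k)))

  -- matrix of the refined bi-alternant:
  -- entry (i,j) = x_i^{λ_j+n-j} ∏_{m=1}^{j-1} (1 + β_m x_i)   (j 0-based here)
  refinedMatrix : (n : ℕ) → (Fin n → ℕ) → Vec Carrier (n ∸ 1) → (Fin n → Carrier)
                → Fin n → Fin n → Carrier
  refinedMatrix n lam β x i j =
    pow (x i) (lam j ℕ.+ (n ∸ suc (toℕ j)))
      * prodList (Data.List.map (λ b → 1# + b * x i) (take (toℕ j) (toList β)))

  vandermonde : (n : ℕ) → (Fin n → Carrier) → Carrier
  vandermonde n x = prodPairs n (λ i j → x i - x j)

  -- refined Grothendieck polynomial G_λ(x | β) = det(...) / ∏_{i<j}(x_i - x_j),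
  -- where vinv is (supplied as) the inverse of the Vandermonde product
  refinedG : (n : ℕ) → (Fin n → ℕ) → Vec Carrier (n ∸ 1) → (Fin n → Carrier) → Carrier → Carrier
  refinedG n lam β x vinv = det n (refinedMatrix n lam β x) * vinv

  qPoints : (n : ℕ) → Carrier → Fin n → Carrier
  qPoints n q i = pow q (toℕ i)

  qDen : (n : ℕ) → Carrier → Fin n → Fin n → Carrier
  qDen n q i j = pow q (n ∸ suc (toℕ j)) - pow q (n ∸ suc (toℕ i))

  qNum : (n : ℕ) → (Fin n → ℕ) → Carrier → (Fin n → ℕ) → Fin n → Fin n → Carrier
  qNum n lam q k i j =
    pow q (lam j ℕ.+ (n ∸ suc (toℕ j)) ℕ.+ k j) - pow q (lam i ℕ.+ (n ∸ suc (toℕ i)) ℕ.+ k i)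

module Submission where

-- Expanding ∏_{m<j} (1 + β_m x) = Σ_t e_t(β_1, …, β_{j-1}) x^t, column j of the bi-alternant
-- matrix is Σ_t e_t(β_1, …, β_{j-1}) (x_i^{λ_j+n-j+t})_i, so by multilinearity the determinant is
-- Σ_k ∏_j e_{k_j}(β_1, …, β_{j-1}) · det(x_i^{λ_j+n-j+k_j}). At x_i = q^{i-1} each of these is a
-- Vandermonde determinant in the points q^{λ_j+n-j+k_j}, and reversing the indices turns the
-- denominator ∏_{i<j} (x_i - x_j) into ∏_{i<j} (q^{n-j} - q^{n-i}).
-- The Vandermonde determinant is computed for the matrix (h_i(y_j, W)) of complete homogeneous
-- polynomials: subtracting the first column from the others leaves (y_j - y_1) h_{i-1}(y_j, y_1, W)
-- below the first row (1, 0, …, 0), so it reduces to the same determinant of size n - 1.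
-- For a single parameter, e_k(β, …, β) with j - 1 arguments is C(j-1, k) β^k.

open import Defs
open import Level using (Level; _⊔_)
open import Algebra.Bundles using (CommutativeRing; RawRing)
open import Data.Nat using (ℕ; zero; suc; _∸_; _≤_; _<_)
open import Data.Nat.Combinatorics using (_C_; nCk+nC[k+1]≡[n+1]C[k+1])
open import Data.Fin using (Fin; zero; suc; toℕ; opposite; punchIn; punchOut; _<?_)
open import Data.Vec using (Vec; toList; replicate)
open import Data.List using (List; []; _∷_; take)
open import Data.Product using (_×_; _,_)

import Algebra.Properties.CommutativeMonoid.Sum
open import Algebra.Solver.Ring.AlmostCommutativeRing
  using (_-Raw-AlmostCommutative⟶_; fromCommutativeRing)
open import Data.Bool using (if_then_else_)
open import Data.Empty using (⊥-elim)
import Data.Fin as Fin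
import Data.Fin.Permutation as Perm
import Data.Fin.Properties as Fin
import Data.List as List
import Data.List.Properties as List
import Data.Maybe as Maybe
import Data.Nat as ℕ
import Data.Nat.Properties as ℕ
open import Data.Product.Properties using (≡-dec)
open import Data.Sum using (_⊎_; inj₁; inj₂)
import Data.Vec.Functional as VF
import Data.Vec.Functional.Properties as VF
open import Function using (_∘_)
open import Relation.Binary.PropositionalEquality as ≡ using (_≡_; _≢_)
open import Relation.Nullary using (Dec; yes; no; ¬_)
open import Relation.Nullary.Decidable using (dec⇒maybe; ⌊_⌋)

module _ {a p} {A : Set a} {P : Set p} where

  if-yes : (p? : Dec P) {x y : A} → P → (if ⌊ p? ⌋ then x else y) ≡ x
  if-yes (yes _) _ = ≡.refl
  if-yes (no ¬p) p = ⊥-elim (¬p p)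

  if-no : (p? : Dec P) {x y : A} → ¬ P → (if ⌊ p? ⌋ then x else y) ≡ y
  if-no (yes p) ¬p = ⊥-elim (¬p p)
  if-no (no _)  _  = ≡.refl

  if-cong : ∀ {q} {Q : Set q} (p? : Dec P) (q? : Dec Q) → (P → Q) → (Q → P) → {x y : A} →
            (if ⌊ p? ⌋ then x else y) ≡ (if ⌊ q? ⌋ then x else y)
  if-cong p? (yes q) _   Q→P = if-yes p? (Q→P q)
  if-cong p? (no ¬q) P→Q _   = if-no p? (¬q ∘ P→Q)

opposite-< : ∀ {n} (i j : Fin n) → toℕ j < toℕ i → toℕ (opposite i) < toℕ (opposite j)
opposite-< {n} i j j<i = ≡.subst₂ _<_ (≡.sym (Fin.opposite-prop i)) (≡.sym (Fin.opposite-prop j))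
  (ℕ.∸-monoʳ-< (ℕ.s≤s j<i) (Fin.toℕ<n i))

opposite-<⁻¹ : ∀ {n} (i j : Fin n) → toℕ (opposite i) < toℕ (opposite j) → toℕ j < toℕ i
opposite-<⁻¹ {n} i j opp<opp = ℕ.s≤s⁻¹ (ℕ.∸-cancelʳ-< {o = n}
  (≡.subst₂ _<_ (Fin.opposite-prop i) (Fin.opposite-prop j) opp<opp))

punchOut-adjacent : ∀ {n} {j a b : Fin (suc n)} (j≢a : j ≢ a) (j≢b : j ≢ b) → toℕ b ≡ suc (toℕ a) →
                    toℕ (punchOut j≢b) ≡ suc (toℕ (punchOut j≢a))
punchOut-adjacent {j = zero}                    {zero}              j≢a _   _     = ⊥-elim (j≢a ≡.refl)
punchOut-adjacent {j = zero}                    {suc a} {suc b}     _   _   b≡1+a = ℕ.suc-injective b≡1+a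
punchOut-adjacent {suc n}       {suc zero}      {zero}  {suc zero}  _   j≢b _     = ⊥-elim (j≢b ≡.refl)
punchOut-adjacent {suc (suc n)} {suc (suc j)}   {zero}  {suc zero}  _   _   _     = ≡.refl
punchOut-adjacent {suc n}       {suc j}         {suc a} {suc b}     j≢a j≢b b≡1+a =
  ≡.cong suc (punchOut-adjacent (j≢a ∘ ≡.cong suc) (j≢b ∘ ≡.cong suc) (ℕ.suc-injective b≡1+a))

punchIn-adjacent : ∀ {n} (a b : Fin (suc n)) → toℕ b ≡ suc (toℕ a) → ∀ s →
                   punchIn a s ≡ punchIn b s ⊎ (punchIn a s ≡ b × punchIn b s ≡ a)
punchIn-adjacent zero    (suc zero) _ zero    = inj₂ (≡.refl , ≡.refl)
punchIn-adjacent zero    (suc zero) _ (suc s) = inj₁ ≡.refl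
punchIn-adjacent {suc n} (suc a) (suc b) _     zero    = inj₁ ≡.refl
punchIn-adjacent {suc n} (suc a) (suc b) b≡1+a (suc s) with punchIn-adjacent a b (ℕ.suc-injective b≡1+a) s
... | inj₁ same         = inj₁ (≡.cong suc same)
... | inj₂ (a↦b , b↦a) = inj₂ (≡.cong suc a↦b , ≡.cong suc b↦a)

module FromℕHomomorphism {c ℓ} (R : CommutativeRing c ℓ) where
  open CommutativeRing R hiding (zero)
  open WithRing R using (fromℕ)
  open import Relation.Binary.Reasoning.Setoid setoid

  fromℕ-+ : ∀ a b → fromℕ (a ℕ.+ b) ≈ fromℕ a + fromℕ b
  fromℕ-+ zero    b = sym (+-identityˡ _)
  fromℕ-+ (suc a) b = trans (+-congˡ (fromℕ-+ a b)) (sym (+-assoc _ _ _))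

  fromℕ-* : ∀ a b → fromℕ (a ℕ.* b) ≈ fromℕ a * fromℕ b
  fromℕ-* zero    b = sym (zeroˡ _)
  fromℕ-* (suc a) b = begin
    fromℕ (b ℕ.+ a ℕ.* b)           ≈⟨ trans (fromℕ-+ b (a ℕ.* b)) (+-congˡ (fromℕ-* a b)) ⟩
    fromℕ b + fromℕ a * fromℕ b     ≈⟨ +-congʳ (*-identityˡ _) ⟨
    1# * fromℕ b + fromℕ a * fromℕ b ≈⟨ distribʳ _ _ _ ⟨
    (1# + fromℕ a) * fromℕ b        ∎

module IntegerRingSolver {c ℓ} (R : CommutativeRing c ℓ) where
  open CommutativeRing R hiding (zero)
  open WithRing R using (fromℕ)
  open FromℕHomomorphism R
  open import Algebra.Properties.Ring ring
    using (-‿+-comm; ⁻¹-anti-homo‿-; x[y-z]≈xy-xz; [y-z]x≈yx-zx; -0#≈0#)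
  open import Relation.Binary.Reasoning.Setoid setoid

  -- The solver must recognise vanishing coefficients, which R (without decidable equality)
  -- cannot do, so the coefficients are integers: a pair (a , b) stands for a - b and the
  -- operations keep it in the canonical form (a ∸ b , b ∸ a), so equal integers have equal
  -- codes and the normal forms of equal polynomials coincide definitionally.
  canonical : ℕ → ℕ → ℕ × ℕ
  canonical a b = a ∸ b , b ∸ a

  integerPairs : RawRing _ _
  integerPairs = record
    { Carrier = ℕ × ℕ
    ; _≈_     = _≡_
    ; _+_     = λ { (a , b) (c , d) → canonical (a ℕ.+ c) (b ℕ.+ d) }
    ; _*_     = λ { (a , b) (c , d) → canonical (a ℕ.* c ℕ.+ b ℕ.* d) (a ℕ.* d ℕ.+ b ℕ.* c) }
    ; -_      = λ { (a , b) → b , a }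
    ; 0#      = 0 , 0
    ; 1#      = 1 , 0
    }

  -- 0 and 1 get their own clauses so that constants in solver goals are 0# and 1# literally.
  ⟦_⟧ : ℕ × ℕ → Carrier
  ⟦ 0 , 0 ⟧ = 0#
  ⟦ 1 , 0 ⟧ = 1#
  ⟦ a , b ⟧ = fromℕ a - fromℕ b

  ⟦⟧-difference : ∀ a b → ⟦ a , b ⟧ ≈ fromℕ a - fromℕ b
  ⟦⟧-difference 0             0       = sym (-‿inverseʳ 0#)
  ⟦⟧-difference 1             0       = sym (trans (+-congˡ -0#≈0#) (trans (+-identityʳ _) (+-identityʳ 1#)))
  ⟦⟧-difference (suc (suc a)) 0       = refl
  ⟦⟧-difference 0             (suc b) = refl
  ⟦⟧-difference 1             (suc b) = refl
  ⟦⟧-difference (suc (suc a)) (suc b) = refl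

  open import Algebra.Properties.CommutativeSemigroup +-commutativeSemigroup using (interchange)

  [a-b]+[c-d]≈[a+c]-[b+d] : ∀ a b c d → (a - b) + (c - d) ≈ (a + c) - (b + d)
  [a-b]+[c-d]≈[a+c]-[b+d] a b c d = trans (interchange a (- b) c (- d)) (+-congˡ (-‿+-comm b d))

  ⟦canonical⟧ : ∀ a b → ⟦ canonical a b ⟧ ≈ fromℕ a - fromℕ b
  ⟦canonical⟧ zero    zero    = ⟦⟧-difference 0 0
  ⟦canonical⟧ zero    (suc b) = ⟦⟧-difference 0 (suc b)
  ⟦canonical⟧ (suc a) zero    = ⟦⟧-difference (suc a) 0
  ⟦canonical⟧ (suc a) (suc b) = begin
    ⟦ canonical a b ⟧                 ≈⟨ ⟦canonical⟧ a b ⟩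
    fromℕ a - fromℕ b                 ≈⟨ +-identityˡ _ ⟨
    0# + (fromℕ a - fromℕ b)          ≈⟨ +-congʳ (-‿inverseʳ 1#) ⟨
    (1# - 1#) + (fromℕ a - fromℕ b)   ≈⟨ [a-b]+[c-d]≈[a+c]-[b+d] 1# 1# (fromℕ a) (fromℕ b) ⟩
    (1# + fromℕ a) - (1# + fromℕ b)   ∎

  ⟦⟧-morphism : integerPairs -Raw-AlmostCommutative⟶ fromCommutativeRing R
  ⟦⟧-morphism = record
    { ⟦_⟧    = ⟦_⟧
    ; +-homo = λ { (a , b) (c , d) → begin
        ⟦ canonical (a ℕ.+ c) (b ℕ.+ d) ⟧       ≈⟨ ⟦canonical⟧ (a ℕ.+ c) (b ℕ.+ d) ⟩
        fromℕ (a ℕ.+ c) - fromℕ (b ℕ.+ d)       ≈⟨ +-cong (fromℕ-+ a c) (-‿cong (fromℕ-+ b d)) ⟩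
        (fromℕ a + fromℕ c) - (fromℕ b + fromℕ d) ≈⟨ [a-b]+[c-d]≈[a+c]-[b+d] _ _ _ _ ⟨
        (fromℕ a - fromℕ b) + (fromℕ c - fromℕ d) ≈⟨ +-cong (⟦⟧-difference a b) (⟦⟧-difference c d) ⟨
        ⟦ a , b ⟧ + ⟦ c , d ⟧                    ∎ }
    ; *-homo = λ { (a , b) (c , d) → begin
        ⟦ canonical (a ℕ.* c ℕ.+ b ℕ.* d) (a ℕ.* d ℕ.+ b ℕ.* c) ⟧
          ≈⟨ ⟦canonical⟧ (a ℕ.* c ℕ.+ b ℕ.* d) (a ℕ.* d ℕ.+ b ℕ.* c) ⟩
        fromℕ (a ℕ.* c ℕ.+ b ℕ.* d) - fromℕ (a ℕ.* d ℕ.+ b ℕ.* c)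
          ≈⟨ +-cong (fromℕ-+* a c b d) (-‿cong (fromℕ-+* a d b c)) ⟩
        (fromℕ a * fromℕ c + fromℕ b * fromℕ d) - (fromℕ a * fromℕ d + fromℕ b * fromℕ c)
          ≈⟨ [a-b]+[c-d]≈[a+c]-[b+d] _ _ _ _ ⟨
        (fromℕ a * fromℕ c - fromℕ a * fromℕ d) + (fromℕ b * fromℕ d - fromℕ b * fromℕ c)
          ≈⟨ +-cong (x[y-z]≈xy-xz _ _ _) (trans (-‿cong (x[y-z]≈xy-xz _ _ _)) (⁻¹-anti-homo‿- _ _)) ⟨
        fromℕ a * (fromℕ c - fromℕ d) - fromℕ b * (fromℕ c - fromℕ d)
          ≈⟨ [y-z]x≈yx-zx _ _ _ ⟨
        (fromℕ a - fromℕ b) * (fromℕ c - fromℕ d)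
          ≈⟨ *-cong (⟦⟧-difference a b) (⟦⟧-difference c d) ⟨
        ⟦ a , b ⟧ * ⟦ c , d ⟧ ∎ }
    ; -‿homo = λ { (a , b) → begin
        ⟦ b , a ⟧             ≈⟨ ⟦⟧-difference b a ⟩
        fromℕ b - fromℕ a     ≈⟨ ⁻¹-anti-homo‿- (fromℕ a) (fromℕ b) ⟨
        - (fromℕ a - fromℕ b) ≈⟨ -‿cong (⟦⟧-difference a b) ⟨
        - ⟦ a , b ⟧           ∎ }
    ; 0-homo = refl
    ; 1-homo = refl
    }
    where
    fromℕ-+* : ∀ a c b d → fromℕ (a ℕ.* c ℕ.+ b ℕ.* d) ≈ fromℕ a * fromℕ c + fromℕ b * fromℕ d
    fromℕ-+* a c b d = trans (fromℕ-+ (a ℕ.* c) (b ℕ.* d)) (+-cong (fromℕ-* a c) (fromℕ-* b d))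

  open import Algebra.Solver.Ring integerPairs (fromCommutativeRing R) ⟦⟧-morphism
    (λ x y → Maybe.map (λ x≡y → reflexive (≡.cong ⟦_⟧ x≡y)) (dec⇒maybe (≡-dec ℕ._≟_ ℕ._≟_ x y)))
    public using (solve; _:=_; con; _:+_; _:*_; _:-_; :-_)

module BigOperators {c ℓ} (R : CommutativeRing c ℓ) where
  open CommutativeRing R hiding (zero)
  open WithRing R
  open IntegerRingSolver R using (solve; _:=_; _:+_; _:*_)
  open import Relation.Binary.Reasoning.Setoid setoid
  open import Algebra.Properties.CommutativeSemigroup *-commutativeSemigroup
    using () renaming (interchange to *-interchange)
  open import Algebra.Properties.CommutativeSemigroup +-commutativeSemigroup
    using () renaming (interchange to +-interchange)
  module Π = Algebra.Properties.CommutativeMonoid.Sum *-commutativeMonoid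

  sumFin-cong : ∀ n {f g : Fin n → Carrier} → (∀ i → f i ≈ g i) → sumFin n f ≈ sumFin n g
  sumFin-cong zero    f≈g = refl
  sumFin-cong (suc n) f≈g = +-cong (f≈g zero) (sumFin-cong n (f≈g ∘ suc))

  sumFin-zero : ∀ n {f : Fin n → Carrier} → (∀ i → f i ≈ 0#) → sumFin n f ≈ 0#
  sumFin-zero zero    f≈0 = refl
  sumFin-zero (suc n) f≈0 = trans (+-cong (f≈0 zero) (sumFin-zero n (f≈0 ∘ suc))) (+-identityʳ 0#)

  sumFin-single : ∀ n {f : Fin n → Carrier} a → (∀ j → j ≢ a → f j ≈ 0#) → sumFin n f ≈ f a
  sumFin-single (suc n) zero    f≈0 =
    trans (+-congˡ (sumFin-zero n (λ j → f≈0 (suc j) λ ()))) (+-identityʳ _)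
  sumFin-single (suc n) (suc a) f≈0 =
    trans (+-cong (f≈0 zero λ ()) (sumFin-single n a (λ j j≢a → f≈0 (suc j) (j≢a ∘ Fin.suc-injective))))
          (+-identityˡ _)

  sumFin-pair : ∀ n {f : Fin n → Carrier} a b → a ≢ b → (∀ j → j ≢ a → j ≢ b → f j ≈ 0#) →
                sumFin n f ≈ f a + f b
  sumFin-pair (suc n) zero    zero    a≢b _   = ⊥-elim (a≢b ≡.refl)
  sumFin-pair (suc n) zero    (suc b) _   f≈0 =
    +-congˡ (sumFin-single n b (λ j j≢b → f≈0 (suc j) (λ ()) (j≢b ∘ Fin.suc-injective)))
  sumFin-pair (suc n) (suc a) zero    _   f≈0 =
    trans (+-congˡ (sumFin-single n a (λ j j≢a → f≈0 (suc j) (j≢a ∘ Fin.suc-injective) (λ ()))))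
          (+-comm _ _)
  sumFin-pair (suc n) (suc a) (suc b) a≢b f≈0 =
    trans (+-cong (f≈0 zero (λ ()) (λ ()))
                  (sumFin-pair n a b (a≢b ∘ ≡.cong suc)
                    (λ j j≢a j≢b → f≈0 (suc j) (j≢a ∘ Fin.suc-injective) (j≢b ∘ Fin.suc-injective))))
          (+-identityˡ _)

  sumFin-linear : ∀ n x y (f g : Fin n → Carrier) →
                  sumFin n (λ i → x * f i + y * g i) ≈ x * sumFin n f + y * sumFin n g
  sumFin-linear zero    x y f g = sym (trans (+-cong (zeroʳ x) (zeroʳ y)) (+-identityʳ 0#))
  sumFin-linear (suc n) x y f g = begin
    (x * f zero + y * g zero) + sumFin n (λ i → x * f (suc i) + y * g (suc i))
      ≈⟨ +-congˡ (sumFin-linear n x y (f ∘ suc) (g ∘ suc)) ⟩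
    (x * f zero + y * g zero) + (x * sumFin n (f ∘ suc) + y * sumFin n (g ∘ suc))
      ≈⟨ solve 6 (λ x y a b u v → (x :* a :+ y :* b) :+ (x :* u :+ y :* v)
                                  := x :* (a :+ u) :+ y :* (b :+ v)) refl x y _ _ _ _ ⟩
    x * sumFin (suc n) f + y * sumFin (suc n) g ∎

  prodFin-cong : ∀ n {f g : Fin n → Carrier} → (∀ i → f i ≈ g i) → prodFin n f ≈ prodFin n g
  prodFin-cong zero    f≈g = refl
  prodFin-cong (suc n) f≈g = *-cong (f≈g zero) (prodFin-cong n (f≈g ∘ suc))

  prodFin-one : ∀ n {f : Fin n → Carrier} → (∀ i → f i ≈ 1#) → prodFin n f ≈ 1#
  prodFin-one zero    f≈1 = refl
  prodFin-one (suc n) f≈1 = trans (*-cong (f≈1 zero) (prodFin-one n (f≈1 ∘ suc))) (*-identityˡ 1#)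

  prodFin-distrib-* : ∀ n (f g : Fin n → Carrier) →
                      prodFin n f * prodFin n g ≈ prodFin n (λ i → f i * g i)
  prodFin-distrib-* zero    f g = *-identityˡ 1#
  prodFin-distrib-* (suc n) f g =
    trans (*-interchange _ _ _ _) (*-congˡ (prodFin-distrib-* n (f ∘ suc) (g ∘ suc)))

  prodFin-comm : ∀ n m (f : Fin n → Fin m → Carrier) →
                 prodFin n (λ i → prodFin m (f i)) ≈ prodFin m (λ j → prodFin n (λ i → f i j))
  prodFin-comm zero    m f = sym (prodFin-one m (λ _ → refl))
  prodFin-comm (suc n) m f =
    trans (*-congˡ (prodFin-comm n m (f ∘ suc))) (prodFin-distrib-* m (f zero) _)

  prodFin≡prod : ∀ n (f : Fin n → Carrier) → prodFin n f ≡ Π.sum f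
  prodFin≡prod zero    f = ≡.refl
  prodFin≡prod (suc n) f = ≡.cong (f zero *_) (prodFin≡prod n (f ∘ suc))

  prodFin-opposite : ∀ n (f : Fin n → Carrier) → prodFin n f ≈ prodFin n (f ∘ opposite)
  prodFin-opposite n f = begin
    prodFin n f            ≡⟨ prodFin≡prod n f ⟩
    Π.sum f                ≈⟨ Π.sum-permute f Perm.reverse ⟩
    Π.sum (f ∘ opposite)   ≡⟨ prodFin≡prod n (f ∘ opposite) ⟨
    prodFin n (f ∘ opposite) ∎

  private
    guard-cong : ∀ {p} {P : Set p} (p? : Dec P) {x y} → (P → x ≈ y) →
                 (if ⌊ p? ⌋ then x else 1#) ≈ (if ⌊ p? ⌋ then y else 1#)
    guard-cong (yes p) x≈y = x≈y p
    guard-cong (no _)  _   = refl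

    guard-one : ∀ {p} {P : Set p} (p? : Dec P) {x} → (P → x ≈ 1#) → (if ⌊ p? ⌋ then x else 1#) ≈ 1#
    guard-one (yes p) x≈1 = x≈1 p
    guard-one (no _)  _   = refl

    guard-* : ∀ {p} {P : Set p} (p? : Dec P) x y →
              (if ⌊ p? ⌋ then x else 1#) * (if ⌊ p? ⌋ then y else 1#) ≈ (if ⌊ p? ⌋ then x * y else 1#)
    guard-* (yes _) x y = refl
    guard-* (no _)  x y = *-identityˡ 1#

  prodPairs-cong : ∀ n {f g : Fin n → Fin n → Carrier} → (∀ i j → toℕ i < toℕ j → f i j ≈ g i j) →
                   prodPairs n f ≈ prodPairs n g
  prodPairs-cong n f≈g = prodFin-cong n λ i → prodFin-cong n λ j → guard-cong (i <? j) (f≈g i j)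

  prodPairs-one : ∀ n {f : Fin n → Fin n → Carrier} → (∀ i j → toℕ i < toℕ j → f i j ≈ 1#) →
                  prodPairs n f ≈ 1#
  prodPairs-one n f≈1 = prodFin-one n λ i → prodFin-one n λ j → guard-one (i <? j) (f≈1 i j)

  prodPairs-distrib-* : ∀ n (f g : Fin n → Fin n → Carrier) →
                        prodPairs n f * prodPairs n g ≈ prodPairs n (λ i j → f i j * g i j)
  prodPairs-distrib-* n f g = trans (prodFin-distrib-* n _ _) (prodFin-cong n λ i →
    trans (prodFin-distrib-* n _ _) (prodFin-cong n λ j → guard-* (i <? j) (f i j) (g i j)))

  prodPairs-suc : ∀ n (f : Fin (suc n) → Fin (suc n) → Carrier) →
                  prodPairs (suc n) f ≈ prodFin n (f zero ∘ suc) * prodPairs n (λ i j → f (suc i) (suc j))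
  prodPairs-suc n f = *-cong (*-identityˡ _) (prodFin-cong n λ i → trans (*-identityˡ _) (prodFin-cong n λ j →
    reflexive (if-cong (suc i <? suc j) (i <? j) ℕ.s≤s⁻¹ ℕ.s≤s)))

  prodPairs-opposite : ∀ n (f : Fin n → Fin n → Carrier) →
                       prodPairs n f ≈ prodPairs n (λ i j → f (opposite j) (opposite i))
  prodPairs-opposite n f = begin
    prodPairs n f
      ≈⟨ prodFin-cong n (λ i → prodFin-opposite n (guarded i)) ⟩
    prodFin n (λ i → prodFin n (guarded i ∘ opposite))
      ≈⟨ prodFin-opposite n _ ⟩
    prodFin n (λ i → prodFin n (guarded (opposite i) ∘ opposite))
      ≈⟨ prodFin-cong n (λ i → prodFin-cong n λ j →
           reflexive (if-cong (opposite i <? opposite j) (j <? i) (opposite-<⁻¹ i j) (opposite-< i j))) ⟩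
    prodFin n (λ i → prodFin n (λ j → if ⌊ j <? i ⌋ then f (opposite i) (opposite j) else 1#))
      ≈⟨ prodFin-comm n n _ ⟩
    prodPairs n (λ i j → f (opposite j) (opposite i)) ∎
    where
    guarded : Fin n → Fin n → Carrier
    guarded i j = if ⌊ i <? j ⌋ then f i j else 1#

  sumTo-cong : ∀ N {f g : ℕ → Carrier} → (∀ t → f t ≈ g t) → sumTo N f ≈ sumTo N g
  sumTo-cong zero    f≈g = f≈g 0
  sumTo-cong (suc N) f≈g = +-cong (sumTo-cong N f≈g) (f≈g (suc N))

  *-distribˡ-sumTo : ∀ N x (f : ℕ → Carrier) → x * sumTo N f ≈ sumTo N (λ t → x * f t)
  *-distribˡ-sumTo zero    x f = refl
  *-distribˡ-sumTo (suc N) x f = trans (distribˡ x _ _) (+-congʳ (*-distribˡ-sumTo N x f))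

  sumTo-distrib-+ : ∀ N (f g : ℕ → Carrier) → sumTo N (λ t → f t + g t) ≈ sumTo N f + sumTo N g
  sumTo-distrib-+ zero    f g = refl
  sumTo-distrib-+ (suc N) f g = trans (+-congʳ (sumTo-distrib-+ N f g)) (+-interchange _ _ _ _)

  sumTo-suc : ∀ N (f : ℕ → Carrier) → sumTo (suc N) f ≈ f 0 + sumTo N (f ∘ suc)
  sumTo-suc zero    f = refl
  sumTo-suc (suc N) f = trans (+-congʳ (sumTo-suc N f)) (+-assoc _ _ _)

  sumTo-head : ∀ N {f : ℕ → Carrier} → (∀ t → f (suc t) ≈ 0#) → sumTo N f ≈ f 0
  sumTo-head zero    _   = refl
  sumTo-head (suc N) f≈0 = trans (+-cong (sumTo-head N f≈0) (f≈0 N)) (+-identityʳ _)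

  sumBounded-cong : ∀ n (bound : Fin n → ℕ) {F G : (Fin n → ℕ) → Carrier} → (∀ k → F k ≈ G k) →
                    sumBounded n bound F ≈ sumBounded n bound G
  sumBounded-cong zero    bound F≈G = F≈G _
  sumBounded-cong (suc n) bound F≈G =
    sumTo-cong (bound zero) λ t → sumBounded-cong n (bound ∘ suc) (λ k → F≈G _)

  *-distribˡ-sumBounded : ∀ n (bound : Fin n → ℕ) x (F : (Fin n → ℕ) → Carrier) →
                          x * sumBounded n bound F ≈ sumBounded n bound (λ k → x * F k)
  *-distribˡ-sumBounded zero    bound x F = refl
  *-distribˡ-sumBounded (suc n) bound x F = trans (*-distribˡ-sumTo (bound zero) x _)
    (sumTo-cong (bound zero) λ t → *-distribˡ-sumBounded n (bound ∘ suc) x _)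

  pow-+ : ∀ x a b → pow x (a ℕ.+ b) ≈ pow x a * pow x b
  pow-+ x zero    b = sym (*-identityˡ _)
  pow-+ x (suc a) b = trans (*-congˡ (pow-+ x a b)) (sym (*-assoc _ _ _))

  pow-* : ∀ x a b → pow (pow x a) b ≈ pow x (a ℕ.* b)
  pow-* x a zero    = reflexive (≡.cong (pow x) (≡.sym (ℕ.*-zeroʳ a)))
  pow-* x a (suc b) = begin
    pow x a * pow (pow x a) b  ≈⟨ *-congˡ (pow-* x a b) ⟩
    pow x a * pow x (a ℕ.* b)  ≈⟨ pow-+ x a (a ℕ.* b) ⟨
    pow x (a ℕ.+ a ℕ.* b)      ≡⟨ ≡.cong (pow x) (ℕ.*-suc a b) ⟨
    pow x (a ℕ.* suc b)        ∎

  pow-pow-comm : ∀ x a b → pow (pow x a) b ≈ pow (pow x b) a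
  pow-pow-comm x a b =
    trans (pow-* x a b) (trans (reflexive (≡.cong (pow x) (ℕ.*-comm a b))) (sym (pow-* x b a)))

module Multilinear {c ℓ} (R : CommutativeRing c ℓ) where
  open CommutativeRing R hiding (zero)
  open WithRing R
  open BigOperators R
  open import Algebra.Properties.Ring ring using (-‿involutive; -0#≈0#)
  open import Relation.Binary.Reasoning.Setoid setoid

  Column : ℕ → Set c
  Column n = Fin n → Carrier

  Form : ℕ → ℕ → Set c
  Form m n = (Fin m → Column n) → Carrier

  _≋_ : ∀ {m n} → (Fin m → Column n) → (Fin m → Column n) → Set ℓ
  cs ≋ cs′ = ∀ j i → cs j i ≈ cs′ j i

  AgreeOutside : ∀ {m n} → Fin m → (Fin m → Column n) → (Fin m → Column n) → Set ℓ
  AgreeOutside a cs cs′ = ∀ j → j ≢ a → ∀ i → cs j i ≈ cs′ j i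

  ∷-agreeOutside-suc : ∀ {m n} {a : Fin m} {cs cs′ : Fin m → Column n} (u : Column n) →
                       AgreeOutside a cs cs′ → AgreeOutside (suc a) (u VF.∷ cs) (u VF.∷ cs′)
  ∷-agreeOutside-suc u agree zero    _     i = refl
  ∷-agreeOutside-suc u agree (suc j) j≢1+a i = agree j (j≢1+a ∘ ≡.cong suc) i

  ∷-agreeOutside-zero : ∀ {m n} (u v : Column n) (cs : Fin m → Column n) →
                        AgreeOutside zero (u VF.∷ cs) (v VF.∷ cs)
  ∷-agreeOutside-zero u v cs zero    0≢0 i = ⊥-elim (0≢0 ≡.refl)
  ∷-agreeOutside-zero u v cs (suc j) _   i = refl

  record IsMultilinear {m n} (D : Form m n) : Set (c ⊔ ℓ) where
    field
      cong   : ∀ {cs cs′} → cs ≋ cs′ → D cs ≈ D cs′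
      linear : ∀ a {cs cs₁ cs₂} x y → AgreeOutside a cs cs₁ → AgreeOutside a cs cs₂ →
               (∀ i → cs a i ≈ x * cs₁ a i + y * cs₂ a i) → D cs ≈ x * D cs₁ + y * D cs₂

    additive : ∀ a {cs cs₁ cs₂} → AgreeOutside a cs cs₁ → AgreeOutside a cs cs₂ →
               (∀ i → cs a i ≈ cs₁ a i + cs₂ a i) → D cs ≈ D cs₁ + D cs₂
    additive a agree₁ agree₂ at-a =
      trans (linear a 1# 1# agree₁ agree₂ (λ i → trans (at-a i) (sym (unit-sum _ _)))) (unit-sum _ _)
      where
      unit-sum : ∀ u v → 1# * u + 1# * v ≈ u + v
      unit-sum u v = +-cong (*-identityˡ u) (*-identityˡ v)

    homogeneous : ∀ a {cs cs₁} x → AgreeOutside a cs cs₁ → (∀ i → cs a i ≈ x * cs₁ a i) →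
                  D cs ≈ x * D cs₁
    homogeneous a x agree at-a =
      trans (linear a x 0# agree agree (λ i → trans (at-a i) (sym (drop-zero _)))) (drop-zero _)
      where
      drop-zero : ∀ u → x * u + 0# * u ≈ x * u
      drop-zero u = trans (+-congˡ (zeroˡ u)) (+-identityʳ _)

  fixFirst : ∀ {m n} → Form (suc m) n → Column n → Form m n
  fixFirst D u cs = D (u VF.∷ cs)

  fixFirst-isMultilinear : ∀ {m n} {D : Form (suc m) n} → IsMultilinear D → ∀ u →
                           IsMultilinear (fixFirst D u)
  fixFirst-isMultilinear D-ml u = record
    { cong   = λ cs≋cs′ → cong λ { zero i → refl ; (suc j) i → cs≋cs′ j i }
    ; linear = λ a x y agree₁ agree₂ at-a →
        linear (suc a) x y (∷-agreeOutside-suc u agree₁) (∷-agreeOutside-suc u agree₂) at-a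
    }
    where open IsMultilinear D-ml

  linear-sumTo : ∀ {m n} {D : Form (suc m) n} → IsMultilinear D →
                 ∀ N (Co : ℕ → Carrier) (A : ℕ → Column n) (cs : Fin m → Column n) →
                 D ((λ i → sumTo N (λ t → Co t * A t i)) VF.∷ cs) ≈ sumTo N (λ t → Co t * D (A t VF.∷ cs))
  linear-sumTo D-ml zero    Co A cs =
    homogeneous zero (Co 0) (∷-agreeOutside-zero _ _ cs) (λ i → refl)
    where open IsMultilinear D-ml
  linear-sumTo D-ml (suc N) Co A cs = trans
    (additive zero (∷-agreeOutside-zero _ _ cs) (∷-agreeOutside-zero _ _ cs) (λ i → refl))
    (+-cong (linear-sumTo D-ml N Co A cs) (homogeneous zero (Co (suc N)) (∷-agreeOutside-zero _ _ cs) (λ i → refl)))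
    where open IsMultilinear D-ml

  multilinear-expansion :
    ∀ {m n} {D : Form m n} → IsMultilinear D →
    ∀ (bound : Fin m → ℕ) (Co : Fin m → ℕ → Carrier) (A : Fin m → ℕ → Column n) →
    D (λ j i → sumTo (bound j) (λ t → Co j t * A j t i))
      ≈ sumBounded m bound (λ k → prodFin m (λ j → Co j (k j)) * D (λ j → A j (k j)))
  multilinear-expansion {zero} D-ml bound Co A = trans (IsMultilinear.cong D-ml λ ()) (sym (*-identityˡ _))
  multilinear-expansion {suc m} {n} {D} D-ml bound Co A = begin
    D (λ j i → sumTo (bound j) (λ t → Co j t * A j t i))
      ≈⟨ cong (λ { zero i → refl ; (suc j) i → refl }) ⟩
    D ((λ i → sumTo (bound zero) (λ t → Co zero t * A zero t i)) VF.∷ rest)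
      ≈⟨ linear-sumTo D-ml (bound zero) (Co zero) (A zero) rest ⟩
    sumTo (bound zero) (λ t → Co zero t * fixFirst D (A zero t) rest)
      ≈⟨ sumTo-cong (bound zero) (λ t → *-congˡ (multilinear-expansion
           (fixFirst-isMultilinear D-ml (A zero t)) (bound ∘ suc) (Co ∘ suc) (A ∘ suc))) ⟩
    sumTo (bound zero) (λ t → Co zero t * sumBounded m (bound ∘ suc) (λ k →
      prodFin m (λ j → Co (suc j) (k j)) * D (A zero t VF.∷ λ j → A (suc j) (k j))))
      ≈⟨ sumTo-cong (bound zero) (λ t → trans (*-distribˡ-sumBounded m (bound ∘ suc) _ _)
           (sumBounded-cong m (bound ∘ suc) λ k → trans (sym (*-assoc _ _ _))
             (*-congˡ (cong λ { zero i → refl ; (suc j) i → refl })))) ⟩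
    sumBounded (suc m) bound (λ k → prodFin (suc m) (λ j → Co j (k j)) * D (λ j → A j (k j))) ∎
    where
    open IsMultilinear D-ml
    rest : Fin m → Column n
    rest j i = sumTo (bound (suc j)) (λ t → Co (suc j) t * A (suc j) t i)

  multilinear-scaling : ∀ {m n} {D : Form m n} → IsMultilinear D →
                        ∀ (x : Fin m → Carrier) (A : Fin m → Column n) →
                        D (λ j i → x j * A j i) ≈ prodFin m x * D A
  multilinear-scaling {zero}  D-ml x A = trans (IsMultilinear.cong D-ml λ ()) (sym (*-identityˡ _))
  multilinear-scaling {suc m} {D = D} D-ml x A = begin
    D (λ j i → x j * A j i)
      ≈⟨ homogeneous zero (x zero) agree (λ i → refl) ⟩
    x zero * fixFirst D (A zero) (λ j i → x (suc j) * A (suc j) i)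
      ≈⟨ *-congˡ (multilinear-scaling (fixFirst-isMultilinear D-ml (A zero)) (x ∘ suc) (A ∘ suc)) ⟩
    x zero * (prodFin m (x ∘ suc) * D (A zero VF.∷ A ∘ suc))
      ≈⟨ trans (sym (*-assoc _ _ _)) (*-congˡ (cong λ { zero i → refl ; (suc j) i → refl })) ⟩
    prodFin (suc m) x * D A ∎
    where
    open IsMultilinear D-ml
    agree : AgreeOutside zero (λ j i → x j * A j i) (A zero VF.∷ λ j i → x (suc j) * A (suc j) i)
    agree zero    0≢0 i = ⊥-elim (0≢0 ≡.refl)
    agree (suc j) _   i = refl

  AdjacentAlternating : ∀ {m n} → Form m n → Set (c ⊔ ℓ)
  AdjacentAlternating {m} D =
    ∀ {cs} (a b : Fin m) → toℕ b ≡ suc (toℕ a) → (∀ i → cs a i ≈ cs b i) → D cs ≈ 0#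

  module Alternating {m n} {D : Form m n} (D-ml : IsMultilinear D) (D-alt : AdjacentAlternating D) where
    open IsMultilinear D-ml

    private
      by-cases : ∀ {p} {P : Fin m → Set p} a b → P a → P b → (∀ j → j ≢ a → j ≢ b → P j) → ∀ j → P j
      by-cases a b Pa Pb Pj j with j Fin.≟ a | j Fin.≟ b
      ... | yes ≡.refl | _          = Pa
      ... | no _       | yes ≡.refl = Pb
      ... | no j≢a     | no j≢b     = Pj j j≢a j≢b

    replace₂ : (Fin m → Column n) → Fin m → Fin m → Column n → Column n → Fin m → Column n
    replace₂ cs a b u v = VF.updateAt (VF.updateAt cs a (λ _ → u)) b (λ _ → v)

    module _ {cs : Fin m → Column n} {a b : Fin m} (a≢b : a ≢ b) where
      replace₂-a : ∀ {u v} i → replace₂ cs a b u v a i ≈ u i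
      replace₂-a i = reflexive (≡.cong-app
        (≡.trans (VF.updateAt-minimal a b _ a≢b) (VF.updateAt-updates a cs)) i)

      replace₂-b : ∀ {u v} i → replace₂ cs a b u v b i ≈ v i
      replace₂-b i = reflexive (≡.cong-app (VF.updateAt-updates b _) i)

      replace₂-other : ∀ {u v} j → j ≢ a → j ≢ b → ∀ i → replace₂ cs a b u v j i ≈ cs j i
      replace₂-other j j≢a j≢b i = reflexive (≡.cong-app
        (≡.trans (VF.updateAt-minimal j b _ j≢b) (VF.updateAt-minimal j a cs j≢a)) i)

      replace₂-characterisation : ∀ {cs′ u v} → (∀ i → cs′ a i ≈ u i) → (∀ i → cs′ b i ≈ v i) →
                                  (∀ j → j ≢ a → j ≢ b → ∀ i → cs′ j i ≈ cs j i) →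
                                  cs′ ≋ replace₂ cs a b u v
      replace₂-characterisation at-a at-b other = by-cases a b
        (λ i → trans (at-a i) (sym (replace₂-a i)))
        (λ i → trans (at-b i) (sym (replace₂-b i)))
        (λ j j≢a j≢b i → trans (other j j≢a j≢b i) (sym (replace₂-other j j≢a j≢b i)))

      replace₂-agreeOutside-a : ∀ {u u′ v} → AgreeOutside a (replace₂ cs a b u v) (replace₂ cs a b u′ v)
      replace₂-agreeOutside-a = by-cases a b
        (λ a≢a → ⊥-elim (a≢a ≡.refl))
        (λ _ i → trans (replace₂-b i) (sym (replace₂-b i)))
        (λ j j≢a j≢b _ i → trans (replace₂-other j j≢a j≢b i) (sym (replace₂-other j j≢a j≢b i)))

      replace₂-agreeOutside-b : ∀ {u v v′} → AgreeOutside b (replace₂ cs a b u v) (replace₂ cs a b u v′)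
      replace₂-agreeOutside-b = by-cases a b
        (λ _ i → trans (replace₂-a i) (sym (replace₂-a i)))
        (λ b≢b → ⊥-elim (b≢b ≡.refl))
        (λ j j≢a j≢b _ i → trans (replace₂-other j j≢a j≢b i) (sym (replace₂-other j j≢a j≢b i)))

    -- B u v, the form with columns a and b set to u and v, is bilinear and vanishes on the
    -- diagonal, so expanding B (u + v) (u + v) = 0 gives B u v + B v u = 0.
    swap-adjacent : ∀ {cs cs′} a b → toℕ b ≡ suc (toℕ a) →
                    (∀ i → cs′ a i ≈ cs b i) → (∀ i → cs′ b i ≈ cs a i) →
                    (∀ j → j ≢ a → j ≢ b → ∀ i → cs′ j i ≈ cs j i) → D cs′ ≈ - D cs
    swap-adjacent {cs} {cs′} a b adjacent at-a at-b other = +-inverseʳ-unique (D cs) (D cs′) (begin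
      D cs + D cs′
        ≈⟨ +-cong (cong (replace₂-characterisation a≢b (λ _ → refl) (λ _ → refl) (λ _ _ _ _ → refl)))
                  (cong (replace₂-characterisation a≢b at-a at-b other)) ⟩
      B (cs a) (cs b) + B (cs b) (cs a)
        ≈⟨ +-cong (+-identityˡ _) (+-identityʳ _) ⟨
      (0# + B (cs a) (cs b)) + (B (cs b) (cs a) + 0#)
        ≈⟨ +-cong (+-congʳ (B-diagonal (cs a))) (+-congˡ (B-diagonal (cs b))) ⟨
      (B (cs a) (cs a) + B (cs a) (cs b)) + (B (cs b) (cs a) + B (cs b) (cs b))
        ≈⟨ +-cong (B-additiveʳ (cs a)) (B-additiveʳ (cs b)) ⟨
      B (cs a) w + B (cs b) w
        ≈⟨ B-additiveˡ w ⟨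
      B w w
        ≈⟨ B-diagonal w ⟩
      0# ∎)
      where
      open import Algebra.Properties.Ring ring using (+-inverseʳ-unique)
      a≢b : a ≢ b
      a≢b a≡b = ℕ.1+n≢n (≡.sym (≡.trans (≡.cong toℕ a≡b) adjacent))
      B : Column n → Column n → Carrier
      B u v = D (replace₂ cs a b u v)
      w : Column n
      w i = cs a i + cs b i
      B-diagonal : ∀ u → B u u ≈ 0#
      B-diagonal u = D-alt a b adjacent (λ i → trans (replace₂-a a≢b i) (sym (replace₂-b a≢b i)))
      B-additiveˡ : ∀ v → B w v ≈ B (cs a) v + B (cs b) v
      B-additiveˡ v = additive a (replace₂-agreeOutside-a a≢b) (replace₂-agreeOutside-a a≢b)
        (λ i → trans (replace₂-a a≢b i) (sym (+-cong (replace₂-a a≢b i) (replace₂-a a≢b i))))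
      B-additiveʳ : ∀ u → B u w ≈ B u (cs a) + B u (cs b)
      B-additiveʳ u = additive b (replace₂-agreeOutside-b a≢b) (replace₂-agreeOutside-b a≢b)
        (λ i → trans (replace₂-b a≢b i) (sym (+-cong (replace₂-b a≢b i) (replace₂-b a≢b i))))

    equal-columns : ∀ d {cs} a b → toℕ b ≡ suc (d ℕ.+ toℕ a) → (∀ i → cs a i ≈ cs b i) → D cs ≈ 0#
    equal-columns zero    a b b≡1+a a≈b = D-alt a b b≡1+a a≈b
    equal-columns (suc d) {cs} a b b≡2+d+a a≈b = begin
      D cs        ≈⟨ -‿involutive (D cs) ⟨
      - - D cs    ≈⟨ -‿cong (swap-adjacent a a₁ a₁≡1+a (replace₂-a a≢a₁) (replace₂-b a≢a₁) (replace₂-other a≢a₁)) ⟨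
      - D swapped ≈⟨ -‿cong (equal-columns d a₁ b b≡1+d+a₁ (λ i →
                      trans (replace₂-b a≢a₁ i) (trans (a≈b i) (sym (replace₂-other a≢a₁ b b≢a b≢a₁ i))))) ⟩
      - 0#        ≈⟨ -0#≈0# ⟩
      0#          ∎
      where
      1+a<b : suc (toℕ a) < toℕ b
      1+a<b = ≡.subst (suc (toℕ a) <_) (≡.sym b≡2+d+a) (ℕ.s≤s (ℕ.s≤s (ℕ.m≤n+m (toℕ a) d)))
      a₁ : Fin m
      a₁ = Fin.fromℕ< (ℕ.<-trans 1+a<b (Fin.toℕ<n b))
      a₁≡1+a : toℕ a₁ ≡ suc (toℕ a)
      a₁≡1+a = Fin.toℕ-fromℕ< _
      a≢a₁ : a ≢ a₁
      a≢a₁ a≡a₁ = ℕ.1+n≢n (≡.sym (≡.trans (≡.cong toℕ a≡a₁) a₁≡1+a))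
      b≢a : b ≢ a
      b≢a b≡a = ℕ.<-irrefl (≡.cong toℕ (≡.sym b≡a)) (ℕ.<-trans (ℕ.n<1+n _) 1+a<b)
      b≢a₁ : b ≢ a₁
      b≢a₁ b≡a₁ = ℕ.<-irrefl (≡.trans (≡.sym a₁≡1+a) (≡.cong toℕ (≡.sym b≡a₁))) 1+a<b
      b≡1+d+a₁ : toℕ b ≡ suc (d ℕ.+ toℕ a₁)
      b≡1+d+a₁ = ≡.trans b≡2+d+a (≡.cong suc (≡.trans (≡.sym (ℕ.+-suc d (toℕ a))) (≡.cong (d ℕ.+_) (≡.sym a₁≡1+a))))
      swapped : Fin m → Column n
      swapped = replace₂ cs a a₁ (cs a₁) (cs a)

  module _ {m n} {D : Form (suc m) n} (D-ml : IsMultilinear D) (D-alt : AdjacentAlternating D) where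
    open IsMultilinear D-ml
    open Alternating D-ml D-alt using (equal-columns)

    add-multiple-of-first : ∀ {cs cs′} j x → AgreeOutside (suc j) cs′ cs →
                            (∀ i → cs′ (suc j) i ≈ cs (suc j) i + x * cs zero i) → D cs′ ≈ D cs
    add-multiple-of-first {cs} {cs′} j x agree at-j = begin
      D cs′                   ≈⟨ linear (suc j) 1# x agree agree-copy (λ i →
                                   trans (at-j i) (+-cong (sym (*-identityˡ _)) (*-congˡ (sym (copy-at i))))) ⟩
      1# * D cs + x * D copy  ≈⟨ +-cong (*-identityˡ _) (trans (*-congˡ copy-vanishes) (zeroʳ x)) ⟩
      D cs + 0#               ≈⟨ +-identityʳ _ ⟩
      D cs                    ∎
      where
      copy : Fin (suc m) → Column n
      copy = VF.updateAt cs (suc j) (λ _ → cs zero)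
      copy-at : ∀ i → copy (suc j) i ≈ cs zero i
      copy-at i = reflexive (≡.cong-app (VF.updateAt-updates (suc j) cs) i)
      copy-outside : ∀ j′ → j′ ≢ suc j → ∀ i → copy j′ i ≈ cs j′ i
      copy-outside j′ j′≢1+j i = reflexive (≡.cong-app (VF.updateAt-minimal j′ (suc j) cs j′≢1+j) i)
      agree-copy : AgreeOutside (suc j) cs′ copy
      agree-copy j′ j′≢1+j i = trans (agree j′ j′≢1+j i) (sym (copy-outside j′ j′≢1+j i))
      copy-vanishes : D copy ≈ 0#
      copy-vanishes = equal-columns (toℕ j) zero (suc j) (≡.cong suc (≡.sym (ℕ.+-identityʳ _)))
        (λ i → trans (copy-outside zero (λ ()) i) (sym (copy-at i)))

    add-multiples-of-first : ∀ {cs cs′} (x : Fin m → Carrier) → (∀ i → cs′ zero i ≈ cs zero i) →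
                             (∀ j i → cs′ (suc j) i ≈ cs (suc j) i + x j * cs zero i) → D cs′ ≈ D cs
    add-multiples-of-first {cs} {cs′} x at-zero at-suc = trans (cong cs′≋partial-m) (partial-invariant m)
      where
      added : Fin m → Column n
      added j i = cs (suc j) i + x j * cs zero i
      partial : ℕ → Fin (suc m) → Column n
      partial k zero    = cs zero
      partial k (suc j) = if ⌊ toℕ j ℕ.<? k ⌋ then added j else cs (suc j)

      partial-invariant : ∀ k → D (partial k) ≈ D cs
      partial-invariant zero = cong λ { zero i → refl ; (suc j) i → refl }
      partial-invariant (suc k) with k ℕ.<? m
      ... | no k≮m = trans (cong λ { zero i → refl ; (suc j) i → reflexive (≡.cong-app (if-cong
              (toℕ j ℕ.<? suc k) (toℕ j ℕ.<? k) (λ _ → below j) (λ _ → ℕ.m<n⇒m<1+n (below j))) i) })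
            (partial-invariant k)
        where
        below : ∀ j → toℕ j < k
        below j = ℕ.<-≤-trans (Fin.toℕ<n j) (ℕ.≮⇒≥ k≮m)
      ... | yes k<m = trans (add-multiple-of-first jₖ (x jₖ) agree at-jₖ) (partial-invariant k)
        where
        jₖ : Fin m
        jₖ = Fin.fromℕ< k<m
        jₖ≡k : toℕ jₖ ≡ k
        jₖ≡k = Fin.toℕ-fromℕ< k<m
        agree : AgreeOutside (suc jₖ) (partial (suc k)) (partial k)
        agree zero    _       i = refl
        agree (suc j) 1+j≢1+jₖ i = reflexive (≡.cong-app (if-cong (toℕ j ℕ.<? suc k) (toℕ j ℕ.<? k)
          (λ j<1+k → ℕ.≤∧≢⇒< (ℕ.s≤s⁻¹ j<1+k) (1+j≢1+jₖ ∘ ≡.cong suc ∘ j≡jₖ)) ℕ.m<n⇒m<1+n) i)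
          where
          j≡jₖ : toℕ j ≡ k → j ≡ jₖ
          j≡jₖ j≡k = Fin.toℕ-injective (≡.trans j≡k (≡.sym jₖ≡k))
        at-jₖ : ∀ i → partial (suc k) (suc jₖ) i ≈ partial k (suc jₖ) i + x jₖ * cs zero i
        at-jₖ i = begin
          partial (suc k) (suc jₖ) i
            ≡⟨ ≡.cong-app (if-yes (toℕ jₖ ℕ.<? suc k) (≡.subst (_< suc k) (≡.sym jₖ≡k) (ℕ.n<1+n k))) i ⟩
          cs (suc jₖ) i + x jₖ * cs zero i
            ≡⟨ ≡.cong (_+ x jₖ * cs zero i) (≡.cong-app
                 (if-no (toℕ jₖ ℕ.<? k) (≡.subst (λ t → ¬ t < k) (≡.sym jₖ≡k) (ℕ.<-irrefl ≡.refl))) i) ⟨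
          partial k (suc jₖ) i + x jₖ * cs zero i ∎

      cs′≋partial-m : cs′ ≋ partial m
      cs′≋partial-m zero    i = at-zero i
      cs′≋partial-m (suc j) i =
        trans (at-suc j i) (sym (reflexive (≡.cong-app (if-yes (toℕ j ℕ.<? m) (Fin.toℕ<n j)) i)))

module Determinant {c ℓ} (R : CommutativeRing c ℓ) where
  open CommutativeRing R hiding (zero)
  open WithRing R
  open BigOperators R
  open Multilinear R
  open IntegerRingSolver R using (solve; _:=_; _:+_; _:*_; :-_; con)
  open import Relation.Binary.Reasoning.Setoid setoid

  detᶜ : ∀ n → (Fin n → Column n) → Carrier
  detᶜ n cs = det n (λ i j → cs j i)

  minor : ∀ {n} → (Fin (suc n) → Column (suc n)) → Fin (suc n) → Fin n → Column n
  minor cs j s r = cs (punchIn j s) (suc r)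

  laplaceTerm : ∀ {n} → (Fin (suc n) → Column (suc n)) → Fin (suc n) → Carrier
  laplaceTerm {n} cs j = altSign (toℕ j) * (cs j zero * detᶜ n (minor cs j))

  detᶜ-cong : ∀ n {cs cs′ : Fin n → Column n} → cs ≋ cs′ → detᶜ n cs ≈ detᶜ n cs′
  detᶜ-cong zero    _      = refl
  detᶜ-cong (suc n) {cs} {cs′} cs≋cs′ = sumFin-cong (suc n) {laplaceTerm cs} {laplaceTerm cs′} λ j →
    *-congˡ (*-cong (cs≋cs′ j zero) (detᶜ-cong n λ s r → cs≋cs′ (punchIn j s) (suc r)))

  minor-agreeOutside : ∀ {n a} {cs cs′ : Fin (suc n) → Column (suc n)} → AgreeOutside a cs cs′ →
                       ∀ {j} (j≢a : j ≢ a) → AgreeOutside (punchOut j≢a) (minor cs j) (minor cs′ j)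
  minor-agreeOutside {a = a} agree {j} j≢a s s≢a′ r = agree (punchIn j s) punchIn≢a (suc r)
    where
    punchIn≢a : punchIn j s ≢ a
    punchIn≢a eq = s≢a′ (Fin.punchIn-injective j s _ (≡.trans eq (≡.sym (Fin.punchIn-punchOut j≢a))))

  minor-same : ∀ {n a} {cs cs′ : Fin (suc n) → Column (suc n)} → AgreeOutside a cs cs′ →
               minor cs a ≋ minor cs′ a
  minor-same {a = a} agree s r = agree (punchIn a s) (Fin.punchInᵢ≢i a s) (suc r)

  minor-punchOut : ∀ {n a j} (cs : Fin (suc n) → Column (suc n)) (j≢a : j ≢ a) r →
                   minor cs j (punchOut j≢a) r ≡ cs a (suc r)
  minor-punchOut cs j≢a r = ≡.cong (λ t → cs t (suc r)) (Fin.punchIn-punchOut j≢a)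

  detᶜ-linear : ∀ n a {cs cs₁ cs₂ : Fin n → Column n} x y →
                AgreeOutside a cs cs₁ → AgreeOutside a cs cs₂ →
                (∀ i → cs a i ≈ x * cs₁ a i + y * cs₂ a i) → detᶜ n cs ≈ x * detᶜ n cs₁ + y * detᶜ n cs₂
  detᶜ-linear (suc n) a {cs} {cs₁} {cs₂} x y agree₁ agree₂ at-a =
    trans (sumFin-cong (suc n) {laplaceTerm cs} term) (sumFin-linear (suc n) x y (laplaceTerm cs₁) (laplaceTerm cs₂))
    where
    term : ∀ j → laplaceTerm cs j ≈ x * laplaceTerm cs₁ j + y * laplaceTerm cs₂ j
    term j with j Fin.≟ a
    ... | yes ≡.refl = begin
      σ * (cs j zero * detᶜ n (minor cs j))
        ≈⟨ *-congˡ (*-congʳ (at-a zero)) ⟩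
      σ * ((x * cs₁ j zero + y * cs₂ j zero) * detᶜ n (minor cs j))
        ≈⟨ solve 6 (λ σ x y u v d → σ :* ((x :* u :+ y :* v) :* d) := x :* (σ :* (u :* d)) :+ y :* (σ :* (v :* d)))
                 refl σ x y _ _ _ ⟩
      x * (σ * (cs₁ j zero * detᶜ n (minor cs j))) + y * (σ * (cs₂ j zero * detᶜ n (minor cs j)))
        ≈⟨ +-cong (*-congˡ (*-congˡ (*-congˡ (detᶜ-cong n (minor-same agree₁)))))
                  (*-congˡ (*-congˡ (*-congˡ (detᶜ-cong n (minor-same agree₂))))) ⟩
      x * laplaceTerm cs₁ j + y * laplaceTerm cs₂ j ∎
      where σ = altSign (toℕ j)
    ... | no j≢a = begin
      σ * (cs j zero * detᶜ n (minor cs j))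
        ≈⟨ *-congˡ (*-congˡ (detᶜ-linear n (punchOut j≢a) x y
             (minor-agreeOutside agree₁ j≢a) (minor-agreeOutside agree₂ j≢a) (λ r →
             ≡.subst₂ (λ u v → u ≈ x * v + y * minor cs₂ j (punchOut j≢a) r)
               (≡.sym (minor-punchOut cs j≢a r)) (≡.sym (minor-punchOut cs₁ j≢a r))
               (trans (at-a (suc r)) (+-congˡ (*-congˡ (reflexive (≡.sym (minor-punchOut cs₂ j≢a r))))))))) ⟩
      σ * (cs j zero * (x * detᶜ n (minor cs₁ j) + y * detᶜ n (minor cs₂ j)))
        ≈⟨ solve 6 (λ σ m x y d₁ d₂ → σ :* (m :* (x :* d₁ :+ y :* d₂)) := x :* (σ :* (m :* d₁)) :+ y :* (σ :* (m :* d₂)))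
                 refl σ _ x y _ _ ⟩
      x * (σ * (cs j zero * detᶜ n (minor cs₁ j))) + y * (σ * (cs j zero * detᶜ n (minor cs₂ j)))
        ≈⟨ +-cong (*-congˡ (*-congˡ (*-congʳ (agree₁ j j≢a zero)))) (*-congˡ (*-congˡ (*-congʳ (agree₂ j j≢a zero)))) ⟩
      x * laplaceTerm cs₁ j + y * laplaceTerm cs₂ j ∎
      where σ = altSign (toℕ j)

  detᶜ-isMultilinear : ∀ n → IsMultilinear (detᶜ n)
  detᶜ-isMultilinear n = record { cong = detᶜ-cong n ; linear = detᶜ-linear n }

  detᶜ-adjacentAlternating : ∀ n → AdjacentAlternating (detᶜ n)
  detᶜ-adjacentAlternating (suc n) {cs} a b b≡1+a a≈b =
    trans (sumFin-pair (suc n) {laplaceTerm cs} a b a≢b other-terms) adjacent-terms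
    where
    a≢b : a ≢ b
    a≢b a≡b = ℕ.1+n≢n (≡.sym (≡.trans (≡.cong toℕ a≡b) b≡1+a))

    other-terms : ∀ j → j ≢ a → j ≢ b → laplaceTerm cs j ≈ 0#
    other-terms j j≢a j≢b = trans (*-congˡ (*-congˡ minor-vanishes)) (trans (*-congˡ (zeroʳ _)) (zeroʳ _))
      where
      minor-vanishes : detᶜ n (minor cs j) ≈ 0#
      minor-vanishes = detᶜ-adjacentAlternating n (punchOut j≢a) (punchOut j≢b)
        (punchOut-adjacent j≢a j≢b b≡1+a)
        (λ r → ≡.subst₂ _≈_ (≡.sym (minor-punchOut cs j≢a r)) (≡.sym (minor-punchOut cs j≢b r)) (a≈b (suc r)))

    same-minor : minor cs b ≋ minor cs a
    same-minor s r with punchIn-adjacent a b b≡1+a s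
    ... | inj₁ same         = reflexive (≡.cong (λ t → cs t (suc r)) (≡.sym same))
    ... | inj₂ (a↦b , b↦a) =
      ≡.subst₂ (λ u v → cs u (suc r) ≈ cs v (suc r)) (≡.sym b↦a) (≡.sym a↦b) (a≈b (suc r))

    adjacent-terms : laplaceTerm cs a + laplaceTerm cs b ≈ 0#
    adjacent-terms = begin
      σ * (cs a zero * detᶜ n (minor cs a)) + altSign (toℕ b) * (cs b zero * detᶜ n (minor cs b))
        ≡⟨ ≡.cong (λ t → laplaceTerm cs a + altSign t * (cs b zero * detᶜ n (minor cs b))) b≡1+a ⟩
      σ * (cs a zero * detᶜ n (minor cs a)) + (- σ) * (cs b zero * detᶜ n (minor cs b))
        ≈⟨ +-congˡ (*-congˡ (*-cong (sym (a≈b zero)) (detᶜ-cong n same-minor))) ⟩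
      σ * (cs a zero * detᶜ n (minor cs a)) + (- σ) * (cs a zero * detᶜ n (minor cs a))
        ≈⟨ solve 2 (λ σ t → σ :* t :+ (:- σ) :* t := con (0 , 0)) refl σ _ ⟩
      0# ∎
      where σ = altSign (toℕ a)

  detᶜ-firstRow-single : ∀ n {cs : Fin (suc n) → Column (suc n)} → (∀ s → cs (suc s) zero ≈ 0#) →
                         detᶜ (suc n) cs ≈ cs zero zero * detᶜ n (λ s r → cs (suc s) (suc r))
  detᶜ-firstRow-single n {cs} first-row = trans (sumFin-single (suc n) {laplaceTerm cs} zero vanishing) (*-identityˡ _)
    where
    vanishing : ∀ j → j ≢ zero → laplaceTerm cs j ≈ 0#
    vanishing zero    0≢0 = ⊥-elim (0≢0 ≡.refl)
    vanishing (suc s) _   = trans (*-congˡ (trans (*-congʳ (first-row s)) (zeroˡ _))) (zeroʳ _)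

module Vandermonde {c ℓ} (R : CommutativeRing c ℓ) where
  open CommutativeRing R hiding (zero)
  open WithRing R
  open BigOperators R
  open Multilinear R
  open Determinant R
  open IntegerRingSolver R using (solve; _:=_; _:+_; _:*_; _:-_; con)
  open import Relation.Binary.Reasoning.Setoid setoid

  -- The complete homogeneous symmetric polynomial h_r(x, xs), split by whether a monomial contains x.
  hsym : ℕ → List Carrier → Carrier
  hsym zero    _        = 1#
  hsym (suc r) []       = 0#
  hsym (suc r) (x ∷ xs) = x * hsym r (x ∷ xs) + hsym (suc r) xs

  hsym-singleton : ∀ r y → hsym r (y ∷ []) ≈ pow y r
  hsym-singleton zero    y = refl
  hsym-singleton (suc r) y = trans (+-identityʳ _) (*-congˡ (hsym-singleton r y))

  hsym-difference : ∀ r a b xs → hsym (suc r) (a ∷ xs) - hsym (suc r) (b ∷ xs) ≈ (a - b) * hsym r (a ∷ b ∷ xs)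
  hsym-difference zero    a b xs =
    solve 3 (λ a b h → (a :* con (1 , 0) :+ h) :- (b :* con (1 , 0) :+ h) := (a :- b) :* con (1 , 0)) refl a b _
  hsym-difference (suc r) a b xs = begin
    (a * hsym (suc r) (a ∷ xs) + h) - (b * hsym (suc r) (b ∷ xs) + h)
      ≈⟨ solve 5 (λ a b hₐ h_b h → (a :* hₐ :+ h) :- (b :* h_b :+ h) := a :* (hₐ :- h_b) :+ (a :- b) :* h_b)
               refl a b _ _ h ⟩
    a * (hsym (suc r) (a ∷ xs) - hsym (suc r) (b ∷ xs)) + (a - b) * hsym (suc r) (b ∷ xs)
      ≈⟨ +-congʳ (*-congˡ (hsym-difference r a b xs)) ⟩
    a * ((a - b) * hsym r (a ∷ b ∷ xs)) + (a - b) * hsym (suc r) (b ∷ xs)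
      ≈⟨ solve 4 (λ a b k h → a :* ((a :- b) :* k) :+ (a :- b) :* h := (a :- b) :* (a :* k :+ h)) refl a b _ _ ⟩
    (a - b) * hsym (suc r) (a ∷ b ∷ xs) ∎
    where h = hsym (suc (suc r)) xs

  vandermonde-hsym : ∀ n xs (y : Fin n → Carrier) →
                     detᶜ n (λ j i → hsym (toℕ i) (y j ∷ xs)) ≈ prodPairs n (λ i j → y j - y i)
  vandermonde-hsym zero    xs y = refl
  vandermonde-hsym (suc n) xs y = begin
    detᶜ (suc n) cs
      ≈⟨ add-multiples-of-first (detᶜ-isMultilinear (suc n)) (detᶜ-adjacentAlternating (suc n))
           {cs} {differences} (λ _ → - 1#) (λ _ → refl) (λ j i → +-congˡ (sym (-1*x≈-x _))) ⟨
    detᶜ (suc n) differences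
      ≈⟨ detᶜ-firstRow-single n {differences} (λ s → -‿inverseʳ 1#) ⟩
    1# * detᶜ n (λ s r → differences (suc s) (suc r))
      ≈⟨ trans (*-identityˡ _) (detᶜ-cong n λ s r → hsym-difference (toℕ r) (y (suc s)) (y zero) xs) ⟩
    detᶜ n (λ s r → (y (suc s) - y zero) * hsym (toℕ r) (y (suc s) ∷ y zero ∷ xs))
      ≈⟨ multilinear-scaling (detᶜ-isMultilinear n) (λ s → y (suc s) - y zero) _ ⟩
    prodFin n (λ s → y (suc s) - y zero) * detᶜ n (λ s r → hsym (toℕ r) (y (suc s) ∷ y zero ∷ xs))
      ≈⟨ *-congˡ (vandermonde-hsym n (y zero ∷ xs) (y ∘ suc)) ⟩
    prodFin n (λ s → y (suc s) - y zero) * prodPairs n (λ i j → y (suc j) - y (suc i))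
      ≈⟨ prodPairs-suc n (λ i j → y j - y i) ⟨
    prodPairs (suc n) (λ i j → y j - y i) ∎
    where
    open import Algebra.Properties.Ring ring using (-1*x≈-x)
    cs : Fin (suc n) → Column (suc n)
    cs j i = hsym (toℕ i) (y j ∷ xs)
    differences : Fin (suc n) → Column (suc n)
    differences zero    = cs zero
    differences (suc s) i = cs (suc s) i - cs zero i

  vandermonde-det : ∀ n (y : Fin n → Carrier) → detᶜ n (λ j i → pow (y j) (toℕ i)) ≈ prodPairs n (λ i j → y j - y i)
  vandermonde-det n y = trans (detᶜ-cong n λ j i → sym (hsym-singleton (toℕ i) (y j))) (vandermonde-hsym n [] y)

module RefinedGrothendieck {c ℓ} (R : CommutativeRing c ℓ) where
  open CommutativeRing R hiding (zero)
  open WithRing R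
  open BigOperators R
  open Multilinear R
  open Determinant R
  open Vandermonde R using (vandermonde-det)
  open IntegerRingSolver R using (solve; _:=_; _:+_; _:*_; con)
  open FromℕHomomorphism R
  open import Relation.Binary.Reasoning.Setoid setoid
  open import Algebra.Properties.CommutativeSemigroup *-commutativeSemigroup
    using (x∙yz≈y∙xz) renaming (interchange to *-interchange)

  esym-generatingFunction : ∀ (bs : List Carrier) x N → List.length bs ≤ N →
                            prodList (List.map (λ b → 1# + b * x) bs) ≈ sumTo N (λ t → esym t bs * pow x t)
  esym-generatingFunction []       x N       _ = sym (trans (sumTo-head N (λ t → zeroˡ _)) (*-identityˡ _))
  esym-generatingFunction (b ∷ bs) x (suc N) (ℕ.s≤s len≤N) = begin
    (1# + b * x) * P
      ≈⟨ solve 3 (λ b x P → (con (1 , 0) :+ b :* x) :* P := P :+ (b :* x) :* P) refl b x P ⟩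
    P + (b * x) * P
      ≈⟨ +-cong (esym-generatingFunction bs x (suc N) (ℕ.m≤n⇒m≤1+n len≤N))
                (*-congˡ (esym-generatingFunction bs x N len≤N)) ⟩
    sumTo (suc N) E + (b * x) * sumTo N E
      ≈⟨ +-cong (sumTo-suc N E) (*-distribˡ-sumTo N (b * x) E) ⟩
    (E 0 + sumTo N (E ∘ suc)) + sumTo N (λ t → (b * x) * E t)
      ≈⟨ trans (+-assoc _ _ _) (+-congˡ (sym (sumTo-distrib-+ N _ _))) ⟩
    E 0 + sumTo N (λ t → E (suc t) + (b * x) * E t)
      ≈⟨ +-congˡ (sumTo-cong N λ t →
           solve 5 (λ e e′ b x p → (e :+ b :* e′) :* (x :* p) := e :* (x :* p) :+ (b :* x) :* (e′ :* p))
                 refl (esym (suc t) bs) (esym t bs) b x (pow x t)) ⟨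
    E 0 + sumTo N (λ t → esym (suc t) (b ∷ bs) * pow x (suc t))
      ≈⟨ sumTo-suc N _ ⟨
    sumTo (suc N) (λ t → esym t (b ∷ bs) * pow x t) ∎
    where
    P = prodList (List.map (λ b → 1# + b * x) bs)
    E : ℕ → Carrier
    E t = esym t bs * pow x t

  module _ (n : ℕ) (lam : Fin n → ℕ) (β : Vec Carrier (n ∸ 1)) where

    exponent : Fin n → ℕ
    exponent j = lam j ℕ.+ (n ∸ suc (toℕ j))

    β< : Fin n → List Carrier
    β< j = take (toℕ j) (toList β)

    refinedMatrix-column : ∀ x i j →
      refinedMatrix n lam β x i j ≈ sumTo (toℕ j) (λ t → esym t (β< j) * pow (x i) (exponent j ℕ.+ t))
    refinedMatrix-column x i j = begin
      pow (x i) (exponent j) * prodList (List.map (λ b → 1# + b * x i) (β< j))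
        ≈⟨ *-congˡ (esym-generatingFunction (β< j) (x i) (toℕ j) length-β<) ⟩
      pow (x i) (exponent j) * sumTo (toℕ j) (λ t → esym t (β< j) * pow (x i) t)
        ≈⟨ *-distribˡ-sumTo (toℕ j) _ _ ⟩
      sumTo (toℕ j) (λ t → pow (x i) (exponent j) * (esym t (β< j) * pow (x i) t))
        ≈⟨ sumTo-cong (toℕ j) (λ t → trans (x∙yz≈y∙xz _ _ _) (*-congˡ (sym (pow-+ (x i) (exponent j) t)))) ⟩
      sumTo (toℕ j) (λ t → esym t (β< j) * pow (x i) (exponent j ℕ.+ t)) ∎
      where
      length-β< : List.length (β< j) ≤ toℕ j
      length-β< = ≡.subst (_≤ toℕ j) (≡.sym (List.length-take (toℕ j) (toList β))) (ℕ.m⊓n≤m _ _)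

    refinedDet-expansion : ∀ x →
      det n (refinedMatrix n lam β x)
        ≈ sumBounded n toℕ (λ k → prodFin n (λ j → esym (k j) (β< j)) * detᶜ n (λ j i → pow (x i) (exponent j ℕ.+ k j)))
    refinedDet-expansion x = trans (detᶜ-cong n λ j i → refinedMatrix-column x i j)
      (multilinear-expansion (detᶜ-isMultilinear n) toℕ (λ j t → esym t (β< j)) (λ j t i → pow (x i) (exponent j ℕ.+ t)))

  powers-qPoints : ∀ n q (m : Fin n → ℕ) →
                   detᶜ n (λ j i → pow (qPoints n q i) (m j)) ≈ prodPairs n (λ i j → pow q (m j) - pow q (m i))
  powers-qPoints n q m =
    trans (detᶜ-cong n λ j i → pow-pow-comm q (toℕ i) (m j)) (vandermonde-det n (λ j → pow q (m j)))

  vandermonde-qPoints : ∀ n q → vandermonde n (qPoints n q) ≈ prodPairs n (qDen n q)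
  vandermonde-qPoints n q = trans (prodPairs-opposite n _) (prodPairs-cong n λ i j _ →
    reflexive (≡.cong₂ _-_ (≡.cong (pow q) (Fin.opposite-prop j)) (≡.cong (pow q) (Fin.opposite-prop i))))

  *-inverse-unique : ∀ {x y z} → x * y ≈ 1# → x * z ≈ 1# → y ≈ z
  *-inverse-unique {x} {y} {z} xy≈1 xz≈1 = begin
    y            ≈⟨ *-identityʳ y ⟨
    y * 1#       ≈⟨ *-congˡ xz≈1 ⟨
    y * (x * z)  ≈⟨ *-assoc y x z ⟨
    (y * x) * z  ≈⟨ *-congʳ (trans (*-comm y x) xy≈1) ⟩
    1# * z       ≈⟨ *-identityˡ z ⟩
    z            ∎

  vandermonde-qPoints-inverse :
    ∀ n q {vinv} {dinv : Fin n → Fin n → Carrier} → vandermonde n (qPoints n q) * vinv ≈ 1# →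
    (∀ i j → toℕ i < toℕ j → qDen n q i j * dinv i j ≈ 1#) → vinv ≈ prodPairs n dinv
  vandermonde-qPoints-inverse n q V*vinv≈1 den*dinv≈1 = *-inverse-unique V*vinv≈1
    (trans (*-congʳ (vandermonde-qPoints n q)) (trans (prodPairs-distrib-* n _ _) (prodPairs-one n den*dinv≈1)))

  refinedG-qPoints :
    ∀ n (lam : Fin n → ℕ) (β : Vec Carrier (n ∸ 1)) q {vinv} {dinv : Fin n → Fin n → Carrier} →
    vandermonde n (qPoints n q) * vinv ≈ 1# → (∀ i j → toℕ i < toℕ j → qDen n q i j * dinv i j ≈ 1#) →
    refinedG n lam β (qPoints n q) vinv
      ≈ sumBounded n toℕ (λ k → prodFin n (λ j → esym (k j) (take (toℕ j) (toList β)))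
                                 * prodPairs n (λ i j → qNum n lam q k i j * dinv i j))
  refinedG-qPoints n lam β q {vinv} {dinv} V*vinv≈1 den*dinv≈1 = begin
    det n (refinedMatrix n lam β (qPoints n q)) * vinv
      ≈⟨ *-cong (refinedDet-expansion n lam β (qPoints n q)) (vandermonde-qPoints-inverse n q V*vinv≈1 den*dinv≈1) ⟩
    sumBounded n toℕ (λ k → E k * detᶜ n (λ j i → pow (qPoints n q i) (exponent n lam β j ℕ.+ k j))) * Dinv
      ≈⟨ trans (*-comm _ _) (*-distribˡ-sumBounded n toℕ Dinv _) ⟩
    sumBounded n toℕ (λ k → Dinv * (E k * detᶜ n (λ j i → pow (qPoints n q i) (exponent n lam β j ℕ.+ k j))))
      ≈⟨ sumBounded-cong n toℕ (λ k → trans (x∙yz≈y∙xz _ _ _) (*-congˡ (trans (*-comm _ _)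
           (trans (*-congʳ (powers-qPoints n q (λ j → exponent n lam β j ℕ.+ k j))) (prodPairs-distrib-* n _ _))))) ⟩
    sumBounded n toℕ (λ k → E k * prodPairs n (λ i j → qNum n lam q k i j * dinv i j)) ∎
    where
    Dinv = prodPairs n dinv
    E : (Fin n → ℕ) → Carrier
    E k = prodFin n (λ j → esym (k j) (β< n lam β j))

  esym-replicate : ∀ b k j m → j ≤ m → esym k (take j (toList (replicate m b))) ≈ fromℕ (j C k) * pow b k
  esym-replicate b zero    zero    m       _ = sym (trans (*-identityʳ _) (+-identityʳ 1#))
  esym-replicate b (suc k) zero    m       _ = sym (zeroˡ _)
  esym-replicate b zero    (suc j) (suc m) _ = sym (trans (*-identityʳ _) (+-identityʳ 1#))
  esym-replicate b (suc k) (suc j) (suc m) (ℕ.s≤s j≤m) = begin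
    esym (suc k) bs + b * esym k bs
      ≈⟨ +-cong (esym-replicate b (suc k) j m j≤m) (*-congˡ (esym-replicate b k j m j≤m)) ⟩
    fromℕ (j C suc k) * (b * pow b k) + b * (fromℕ (j C k) * pow b k)
      ≈⟨ solve 4 (λ u v b p → u :* (b :* p) :+ b :* (v :* p) := (v :+ u) :* (b :* p)) refl _ _ b _ ⟩
    (fromℕ (j C k) + fromℕ (j C suc k)) * pow b (suc k)
      ≈⟨ *-congʳ (fromℕ-+ (j C k) (j C suc k)) ⟨
    fromℕ (j C k ℕ.+ j C suc k) * pow b (suc k)
      ≡⟨ ≡.cong (λ t → fromℕ t * pow b (suc k)) (nCk+nC[k+1]≡[n+1]C[k+1] j k) ⟩
    fromℕ (suc j C suc k) * pow b (suc k) ∎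
    where bs = take j (toList (replicate m b))

  prodFin-fromℕ-pow : ∀ n (f k : Fin n → ℕ) b →
                      prodFin n (λ j → fromℕ (f j) * pow b (k j)) ≈ fromℕ (prodℕ n f) * pow b (sumℕ n k)
  prodFin-fromℕ-pow zero    f k b = sym (trans (*-identityʳ _) (+-identityʳ 1#))
  prodFin-fromℕ-pow (suc n) f k b = begin
    (fromℕ (f zero) * pow b (k zero)) * prodFin n (λ j → fromℕ (f (suc j)) * pow b (k (suc j)))
      ≈⟨ *-congˡ (prodFin-fromℕ-pow n (f ∘ suc) (k ∘ suc) b) ⟩
    (fromℕ (f zero) * pow b (k zero)) * (fromℕ (prodℕ n (f ∘ suc)) * pow b (sumℕ n (k ∘ suc)))
      ≈⟨ *-interchange _ _ _ _ ⟩
    (fromℕ (f zero) * fromℕ (prodℕ n (f ∘ suc))) * (pow b (k zero) * pow b (sumℕ n (k ∘ suc)))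
      ≈⟨ *-cong (fromℕ-* (f zero) _) (pow-+ b (k zero) _) ⟨
    fromℕ (prodℕ (suc n) f) * pow b (sumℕ (suc n) k) ∎

  grothendieck-qPoints :
    ∀ n (lam : Fin n → ℕ) q {vinv} {dinv : Fin n → Fin n → Carrier} →
    vandermonde n (qPoints n q) * vinv ≈ 1# → (∀ i j → toℕ i < toℕ j → qDen n q i j * dinv i j ≈ 1#) →
    ∀ b → refinedG n lam (replicate (n ∸ 1) b) (qPoints n q) vinv
            ≈ sumBounded n toℕ (λ k → fromℕ (prodℕ n (λ j → toℕ j C k j))
                                     * (pow b (sumℕ n k) * prodPairs n (λ i j → qNum n lam q k i j * dinv i j)))
  grothendieck-qPoints n lam q V*vinv≈1 den*dinv≈1 b =
    trans (refinedG-qPoints n lam (replicate (n ∸ 1) b) q V*vinv≈1 den*dinv≈1)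
          (sumBounded-cong n toℕ λ k → trans (*-congʳ (trans
            (prodFin-cong n λ j → esym-replicate b (k j) (toℕ j) (n ∸ 1) (toℕ≤n∸1 j))
            (prodFin-fromℕ-pow n (λ j → toℕ j C k j) k b))) (*-assoc _ _ _))
    where
    toℕ≤n∸1 : ∀ {n} (j : Fin n) → toℕ j ≤ n ∸ 1
    toℕ≤n∸1 {suc n} j = Fin.toℕ≤pred[n] j


theorem3p5 : ∀ {c ℓ : Level} (R : CommutativeRing c ℓ) →
    let open CommutativeRing R hiding (zero)
        open WithRing R
    in (n : ℕ) → 1 ≤ n →
       (lam : Fin n → ℕ) → IsPartition n lam →
       (q : Carrier) →
       (vinv : Carrier) → vandermonde n (qPoints n q) * vinv ≈ 1# →
       (dinv : Fin n → Fin n → Carrier) →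
       (∀ (i j : Fin n) → toℕ i < toℕ j → qDen n q i j * dinv i j ≈ 1#) →
       ((β : Vec Carrier (n ∸ 1)) →
          refinedG n lam β (qPoints n q) vinv
          ≈ sumBounded n toℕ (λ k →
              prodFin n (λ j → esym (k j) (take (toℕ j) (toList β)))
              * prodPairs n (λ i j → qNum n lam q k i j * dinv i j)))
       ×
       ((b : Carrier) →
          refinedG n lam (replicate (n ∸ 1) b) (qPoints n q) vinv
          ≈ sumBounded n toℕ (λ k →
              fromℕ (prodℕ n (λ j → toℕ j C k j))
              * (pow b (sumℕ n k)
              * prodPairs n (λ i j → qNum n lam q k i j * dinv i j))))
theorem3p5 R n _ lam _ q vinv V*vinv≈1 dinv den*dinv≈1 =
  (λ β → refinedG-qPoints n lam β q V*vinv≈1 den*dinv≈1) , grothendieck-qPoints n lam q V*vinv≈1 den*dinv≈1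
  where open RefinedGrothendieck R
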